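{- Let $\mathbf H$ be a finite atomic connected hypergraph. For every construct $X(T_1,\dots,T_n)$ of $\mathbf H$ and every $x\in X$, there exists a construction of $\mathbf H$ of the form $\{x\}(S_1,\dots,S_m)$ (i.e. whose root is labelled $\{x\}$) such that $\{x\}(S_1,\dots,S_m)\le^{\mathbf H}X(T_1,\dots,T_n)$.
   Context: A hypergraph $\mathbf{H}$ on a finite set $H$ is a set $\mathbf{H}\subseteq\mathcal{P}(H)\setminus\{\emptyset\}$ with $\bigcup\mathbf{H}=H$; atomic means $\{x\}\in\mathbf{H}$ for all $x\in H$. For $X\subseteq H$, $\mathbf{H}_X=\{Z\in\mathbf{H}: Z\subseteq X\}$. $\mathbf{H}$ is connected if there is no partition $H=X_1\cup X_2$ into non-empty disjoint sets with $\mathbf{H}=\mathbf{H}_{X_1}\cup\mathbf{H}_{X_2}$. $\mathbf{H},X\leadsto H_1,\dots,H_n$ means that $H_1,\dots,H_n$ are the connected components of $\mathbf{H}_{H\setminus X}$, and $\mathbf{H}_i:=\mathbf{H}_{H_i}$. Constructs of connected $\mathbf H$: for non-empty $Y\subseteq H$, if $Y=H$ the one-node tree $H$ is a construct; if $Y\ne H$, $\mathbf H,Y\leadsto H_1,\dots,H_n$ and $T_i$ are constructs of $\mathbf H_i$, then $Y(T_1,\dots,T_n)$ (root labelled $Y$, unordered subtrees $T_i$) is a construct. A construction is a construct all of whose labels are singletons. $\le^{\mathbf H}$: the smallest reflexive transitive relation on constructs such that (i) $Y(X(T_{11},\dots,T_{1m}),T_2,\dots,T_n)\le^{\mathbf H}(Y\cup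 X)(T_{11},\dots,T_{1m},T_2,\dots,T_n)$ whenever $\emptyset\ne Y\subsetneq H$, $\mathbf H,Y\leadsto K_1,\dots,K_n$, $\emptyset\neq X\subseteq K_1$, $\mathbf K_1,X\leadsto H_{11},\dots,H_{1m}$, $T_{1j}$ constructs of $\mathbf H_{1j}$, $T_i$ constructs of $\mathbf K_i$ ($i\ge2$); (ii) $Y(T_1,T_2,\dots,T_n)\le^{\mathbf H}Y(T_1',T_2,\dots,T_n)$ whenever $\mathbf H,Y\leadsto H_1,\dots,H_n$ and $T_1\le^{\mathbf H_1}T_1'$. -}

module Defs where

open import Data.Nat using (ℕ)
open import Data.Fin using (Fin)
open import Data.Fin.Subset
  using (Subset; _∈_; _⊆_; _∪_; _∩_; _─_; ⋃; ⁅_⁆; Nonempty; Empty)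
open import Data.Fin.Subset.Properties using (_⊆?_)
open import Data.List using (List; []; _∷_; filter)
import Data.List.Membership.Propositional as LM
open import Data.List.Relation.Unary.All using (All)
open import Data.List.Relation.Unary.Unique.Propositional using (Unique)
open import Data.List.Relation.Binary.Pointwise using (Pointwise)
open import Data.List.Relation.Binary.Permutation.Propositional using (_↭_)
open import Data.Product using (Σ; ∃; _×_)
open import Data.Sum using (_⊎_)
open import Relation.Binary.PropositionalEquality using (_≡_)
open import Relation.Nullary using (¬_)

module _ {N : ℕ} where

  -- A finite hypergraph on (a subset of) Fin N is given by its list of edges;
  -- its vertex set is the union of its edges.
  Hypergraph : Set
  Hypergraph = List (Subset N)

  vertices : Hypergraph → Subset N
  vertices E = ⋃ E

  NoEmptyEdge : Hypergraph → Set
  NoEmptyEdge E = All Nonempty E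

  Atomic : Hypergraph → Set
  Atomic E = ∀ x → x ∈ vertices E → ⁅ x ⁆ LM.∈ E

  restrict : Hypergraph → Subset N → Hypergraph
  restrict E X = filter (_⊆? X) E

  Disjoint : Subset N → Subset N → Set
  Disjoint A B = Empty (A ∩ B)

  Connected : Hypergraph → Set
  Connected E = ∀ X₁ X₂ → X₁ ∪ X₂ ≡ vertices E → Disjoint X₁ X₂
    → Nonempty X₁ → Nonempty X₂
    → ¬ (∀ e → e LM.∈ E → e ⊆ X₁ ⊎ e ⊆ X₂)

  IsComponent : Hypergraph → Subset N → Subset N → Set
  IsComponent E W C =
    Nonempty C × C ⊆ vertices (restrict E W) ×
    vertices (restrict E C) ≡ C × Connected (restrict E C) ×
    (∀ e → e LM.∈ restrict E W → Nonempty (e ∩ C) → e ⊆ C)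

  Components : Hypergraph → Subset N → Subset N → List (Subset N) → Set
  Components E V X Cs =
    Unique Cs × All (IsComponent E (V ─ X)) Cs ×
    (∀ C → IsComponent E (V ─ X) C → C LM.∈ Cs)

  -- raw rooted trees with subset labels (children as a list; the order
  -- of children is irrelevant, see the permutation rule of _≤[_,_]_)
  data Tree : Set where
    node : Subset N → List Tree → Tree

  -- t is a construct of 𝐇_V (for E the ambient hypergraph).
  -- The one-node case Y = V is the instance with no components.
  data IsConstruct (E : Hypergraph) (V : Subset N) : Tree → Set where
    mk : ∀ {Y ts} (Cs : List (Subset N)) →
         Nonempty Y → Y ⊆ V →
         Components E V Y Cs →
         Pointwise (IsConstruct E) Cs ts →
         IsConstruct E V (node Y ts)

  data IsConstruction : Tree → Set where
    mk : ∀ {x ts} → All IsConstruction ts → IsConstruction (node ⁅ x ⁆ ts)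

  data _≤[_,_]_ : Tree → Hypergraph → Subset N → Tree → Set where
    refl′ : ∀ {E V t} → IsConstruct E V t → t ≤[ E , V ] t
    trans′ : ∀ {E V s t u} → s ≤[ E , V ] t → t ≤[ E , V ] u → s ≤[ E , V ] u
    perm : ∀ {E V Y ts ts′} → IsConstruct E V (node Y ts) → ts ↭ ts′ →
           node Y ts ≤[ E , V ] node Y ts′
    merge : ∀ {E V Y X us ts} →
            ¬ (Y ≡ V) →
            IsConstruct E V (node Y (node X us ∷ ts)) →
            node Y (node X us ∷ ts) ≤[ E , V ] node (Y ∪ X) (Data.List._++_ us ts)
    congr : ∀ {E V Y C Cs t t′ ts} →
            Nonempty Y → Y ⊆ V →
            Components E V Y (C ∷ Cs) →
            Pointwise (IsConstruct E) Cs ts →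
            t ≤[ E , C ] t′ →
            node Y (t ∷ ts) ≤[ E , V ] node Y (t′ ∷ ts)

module Submission where

-- We prove this for every
-- restriction 𝐇_V, by induction on |V| and, for fixed V, on |X|.
--
-- Let y ∈ X with Y = X ∖ {y} non-empty, and let K
--   be the component of 𝐇_{V∖Y} containing y.  The children of X(T⃗) whose
--   components lie inside K form a construct {y}(T⃗ᴬ) of 𝐇_K, and X(T⃗) arises
--   by rule (i) from the construct Y({y}(T⃗ᴬ), T⃗ᴮ).  This rests on a small
--   theory of connected components: the component of a vertex exists (by
--   atomicity) and is unique, and the components below Y and below {y} are
--   obtained from those below X as described in the module `Unmerge`.
-- * Unmerging repeatedly strips the root label down to {x} (`shrinkRoot`).
-- * Below a root {x}, every child is a construct of a component C ⊊ V, hence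
--   lies above a construction by induction on |V|; rule (ii), applied child by
--   child, lowers the whole tree (`lowerChildren`, `singletonRoot`).

open import Defs
open import Data.Nat using (ℕ; zero; suc; _<_)
import Data.Nat.Properties as ℕ
open import Data.Fin using (Fin; zero; suc)
import Data.Fin as Fin
open import Data.Fin.Properties using (any?)
open import Data.Fin.Subset
  using (Subset; _∈_; _∉_; _⊆_; _∪_; _∩_; _─_; _-_; ⋃; ⁅_⁆; Nonempty; Empty; inside; outside; ∣_∣)
open import Data.Fin.Subset.Properties
open import Data.List using (List; []; _∷_; filter; _++_; [_])
open import Data.List.Properties using (++-assoc)
open import Data.List.Membership.Propositional using () renaming (_∈_ to _∈ₗ_)
open import Data.List.Membership.Propositional.Properties using (∈-filter⁺; ∈-filter⁻)
open import Data.List.Relation.Unary.All as All using (All; []; _∷_)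
open import Data.List.Relation.Unary.Any using (here; there)
import Data.List.Relation.Unary.AllPairs as AllPairs
import Data.List.Relation.Unary.Unique.Propositional.Properties as Unique
open import Data.List.Relation.Binary.Pointwise as Pointwise using (Pointwise; []; _∷_)
open import Data.List.Relation.Binary.Permutation.Propositional as ↭
  using (_↭_; ↭-refl; ↭-sym; ↭-trans; prep; ↭⇒↭ₛ)
open import Data.List.Relation.Binary.Permutation.Propositional.Properties
  using (shift; All-resp-↭; ∈-resp-↭)
import Data.List.Relation.Binary.Permutation.Setoid.Properties as ↭ₛ
open import Data.Product using (∃; ∃₂; _×_; _,_; proj₁; proj₂)
open import Data.Sum using (_⊎_; inj₁; inj₂; [_,_]′)
import Data.Sum as Sum
open import Data.Empty using (⊥; ⊥-elim)
import Data.Vec as Vec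
import Data.Vec.Properties as VecP
open import Function using (_∘_)
open import Level using (0ℓ)
open import Relation.Binary.PropositionalEquality
  using (_≡_; _≢_; refl; sym; trans; subst; subst₂; setoid)
open import Relation.Nullary using (¬_; Dec; yes; no; does)
open import Relation.Nullary.Decidable using (¬?; _×-dec_; _→-dec_; dec-true; decidable-stable)
open import Relation.Unary using (Pred; Decidable)

x∈p─q⇒x∉q : ∀ {n} (p q : Subset n) {x} → x ∈ p ─ q → x ∉ q
x∈p─q⇒x∉q (_ Vec.∷ p) (inside  Vec.∷ q) {zero}  ()
x∈p─q⇒x∉q (_ Vec.∷ p) (outside Vec.∷ q) {zero}  _ = λ ()
x∈p─q⇒x∉q (_ Vec.∷ p) (_       Vec.∷ q) {suc _} (Vec.there m) (Vec.there m′) = x∈p─q⇒x∉q p q m m′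

∈⋃⁻ : ∀ {n} (ps : List (Subset n)) {x} → x ∈ ⋃ ps → ∃ λ p → p ∈ₗ ps × x ∈ p
∈⋃⁻ []       x∈⋃ = ⊥-elim (∉⊥ x∈⋃)
∈⋃⁻ (p ∷ ps) x∈⋃ with x∈p∪q⁻ p (⋃ ps) x∈⋃
... | inj₁ x∈p = p , here refl , x∈p
... | inj₂ x∈⋃ps = let (q , q∈ps , x∈q) = ∈⋃⁻ ps x∈⋃ps in q , there q∈ps , x∈q

∈⋃⁺ : ∀ {n} (ps : List (Subset n)) {x p} → p ∈ₗ ps → x ∈ p → x ∈ ⋃ ps
∈⋃⁺ (p ∷ ps) (here refl)  x∈p = x∈p∪q⁺ (inj₁ x∈p)
∈⋃⁺ (q ∷ ps) (there p∈ps) x∈p = x∈p∪q⁺ (inj₂ (∈⋃⁺ ps p∈ps x∈p))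

─-antitoneʳ : ∀ {n} (p : Subset n) {q r} → q ⊆ r → p ─ r ⊆ p ─ q
─-antitoneʳ p {q} {r} q⊆r x∈p─r =
  x∈p∧x∉q⇒x∈p─q (p─q⊆p p r x∈p─r) (x∈p─q⇒x∉q p r x∈p─r ∘ q⊆r)

x∈p─[q-y]⇒x∈p─q : ∀ {n} (p q : Subset n) {x y} → x ∈ p ─ (q - y) → x ≢ y → x ∈ p ─ q
x∈p─[q-y]⇒x∈p─q p q x∈ x≢y =
  x∈p∧x∉q⇒x∈p─q (p─q⊆p p _ x∈) (λ x∈q → x∈p─q⇒x∉q p _ x∈ (x∈p∧x≢y⇒x∈p-y x∈q x≢y))

p∩q∪p─q≡p : ∀ {n} (p q : Subset n) → (p ∩ q) ∪ (p ─ q) ≡ p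
p∩q∪p─q≡p p q = ⊆-antisym parts⊆p p⊆parts
  where
  parts⊆p : (p ∩ q) ∪ (p ─ q) ⊆ p
  parts⊆p x∈ = [ proj₁ ∘ x∈p∩q⁻ p q , p─q⊆p p q ]′ (x∈p∪q⁻ (p ∩ q) (p ─ q) x∈)
  p⊆parts : p ⊆ (p ∩ q) ∪ (p ─ q)
  p⊆parts {x} x∈p with x ∈? q
  ... | yes x∈q = x∈p∪q⁺ (inj₁ (x∈p∩q⁺ (x∈p , x∈q)))
  ... | no  x∉q = x∈p∪q⁺ (inj₂ (x∈p∧x∉q⇒x∈p─q x∈p x∉q))

p-x∪⁅x⁆≡p : ∀ {n} {p : Subset n} {x} → x ∈ p → (p - x) ∪ ⁅ x ⁆ ≡ p
p-x∪⁅x⁆≡p {p = p} {x} x∈p = ⊆-antisym ⊆p p⊆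
  where
  ⊆p : (p - x) ∪ ⁅ x ⁆ ⊆ p
  ⊆p z∈ = [ p─q⊆p p ⁅ x ⁆ , (λ z∈x → subst (_∈ p) (sym (x∈⁅y⁆⇒x≡y x z∈x)) x∈p) ]′
            (x∈p∪q⁻ (p - x) ⁅ x ⁆ z∈)
  p⊆ : p ⊆ (p - x) ∪ ⁅ x ⁆
  p⊆ {z} z∈p with z Fin.≟ x
  ... | yes refl = x∈p∪q⁺ (inj₂ (x∈⁅x⁆ x))
  ... | no  z≢x  = x∈p∪q⁺ (inj₁ (x∈p∧x≢y⇒x∈p-y z∈p z≢x))

⁅x⁆-or-other : ∀ {n} {p : Subset n} {x} → x ∈ p → ⁅ x ⁆ ≡ p ⊎ ∃ λ y → y ∈ p × y ≢ x
⁅x⁆-or-other {p = p} {x} x∈p with any? (λ y → (y ∈? p) ×-dec ¬? (y Fin.≟ x))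
... | yes other = inj₂ other
... | no  none  = inj₁ (⊆-antisym ⁅x⁆⊆p p⊆⁅x⁆)
  where
  ⁅x⁆⊆p : ⁅ x ⁆ ⊆ p
  ⁅x⁆⊆p y∈x = subst (_∈ p) (sym (x∈⁅y⁆⇒x≡y x y∈x)) x∈p
  p⊆⁅x⁆ : p ⊆ ⁅ x ⁆
  p⊆⁅x⁆ {y} y∈p = decidable-stable (y ∈? ⁅ x ⁆) (λ y∉x → none (y , y∈p , x∉⁅y⁆⇒x≢y y∉x))

select : ∀ {n} {P : Pred (Fin n) 0ℓ} → Decidable P → Subset n
select P? = Vec.tabulate (does ∘ P?)

∈select⁺ : ∀ {n} {P : Pred (Fin n) 0ℓ} (P? : Decidable P) {v} → P v → v ∈ select P?
∈select⁺ P? {v} Pv =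
  VecP.lookup⇒[]= v _ (trans (VecP.lookup∘tabulate (does ∘ P?) v) (dec-true (P? v) Pv))

∈select⁻ : ∀ {n} {P : Pred (Fin n) 0ℓ} (P? : Decidable P) {v} → v ∈ select P? → P v
∈select⁻ {P = P} P? {v} v∈ =
  fromDoes (P? v) (trans (sym (VecP.lookup∘tabulate (does ∘ P?) v)) (VecP.[]=⇒lookup v∈))
  where
  fromDoes : (d : Dec (P v)) → does d ≡ inside → P v
  fromDoes (yes Pv) _ = Pv
  fromDoes (no  _)  ()

module _ {A B : Set} {R : A → B → Set} where

  Pointwise-↭ʳ : ∀ {as bs bs′} → Pointwise R as bs → bs ↭ bs′ →
    ∃ λ as′ → as ↭ as′ × Pointwise R as′ bs′
  Pointwise-↭ʳ rs ↭.refl = _ , ↭-refl , rs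
  Pointwise-↭ʳ (r ∷ rs) (↭.prep _ σ) =
    let (as′ , τ , rs′) = Pointwise-↭ʳ rs σ in _ , prep _ τ , r ∷ rs′
  Pointwise-↭ʳ (r ∷ r′ ∷ rs) (↭.swap _ _ σ) =
    let (as′ , τ , rs′) = Pointwise-↭ʳ rs σ in _ , ↭.swap _ _ τ , r′ ∷ r ∷ rs′
  Pointwise-↭ʳ rs (↭.trans σ σ′) =
    let (as₁ , τ  , rs₁) = Pointwise-↭ʳ rs σ
        (as₂ , τ′ , rs₂) = Pointwise-↭ʳ rs₁ σ′
    in as₂ , ↭-trans τ τ′ , rs₂

  Pointwise-partition : ∀ {P : Pred A 0ℓ} (P? : Decidable P) {as bs} → Pointwise R as bs →
    ∃₂ λ bsᵃ bsᵇ → Pointwise R (filter P? as) bsᵃ ×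
                   Pointwise R (filter (¬? ∘ P?) as) bsᵇ × bs ↭ bsᵃ ++ bsᵇ
  Pointwise-partition P? [] = [] , [] , [] , [] , ↭-refl
  Pointwise-partition P? {a ∷ _} (r ∷ rs) with P? a | Pointwise-partition P? rs
  ... | yes _ | bsᵃ , bsᵇ , rsᵃ , rsᵇ , σ = _ , bsᵇ , r ∷ rsᵃ , rsᵇ , prep _ σ
  ... | no  _ | bsᵃ , bsᵇ , rsᵃ , rsᵇ , σ =
    bsᵃ , _ , rsᵃ , r ∷ rsᵇ , ↭-trans (prep _ σ) (↭-sym (shift _ bsᵃ bsᵇ))

module _ {N : ℕ} (E : Hypergraph {N}) where

  restrict⁻ : ∀ {A e} → e ∈ₗ restrict E A → e ∈ₗ E × e ⊆ A
  restrict⁻ {A} = ∈-filter⁻ (_⊆? A)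

  restrict⁺ : ∀ {A e} → e ∈ₗ E → e ⊆ A → e ∈ₗ restrict E A
  restrict⁺ {A} = ∈-filter⁺ (_⊆? A)

  restrict-move : ∀ {A B e} → e ∈ₗ restrict E A → e ⊆ B → e ∈ₗ restrict E B
  restrict-move e∈ = restrict⁺ (proj₁ (restrict⁻ e∈))

  vertices-restrict⊆ : ∀ A → vertices (restrict E A) ⊆ A
  vertices-restrict⊆ A v∈ = let (e , e∈ , v∈e) = ∈⋃⁻ (restrict E A) v∈ in proj₂ (restrict⁻ e∈) v∈e

  restrict-mono : ∀ {A B e} → A ⊆ B → e ∈ₗ restrict E A → e ∈ₗ restrict E B
  restrict-mono A⊆B e∈ = restrict-move e∈ (A⊆B ∘ proj₂ (restrict⁻ e∈))

  vertices-restrict-mono : ∀ {A B} → A ⊆ B → vertices (restrict E A) ⊆ vertices (restrict E B)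
  vertices-restrict-mono {A} {B} A⊆B v∈ =
    let (e , e∈ , v∈e) = ∈⋃⁻ (restrict E A) v∈ in ∈⋃⁺ (restrict E B) (restrict-mono A⊆B e∈) v∈e

  ClosedIn : Subset N → Subset N → Set
  ClosedIn W S = ∀ e → e ∈ₗ restrict E W → Nonempty (e ∩ S) → e ⊆ S

  ClosedIn? : ∀ W S → Dec (ClosedIn W S)
  ClosedIn? W S with All.all? (λ e → nonempty? (e ∩ S) →-dec (e ⊆? S)) (restrict E W)
  ... | yes closed = yes (λ e e∈ → All.lookup closed e∈)
  ... | no  notClosed = no (λ closed → notClosed (All.tabulate (λ {e} e∈ → closed e e∈)))

  component-nonempty : ∀ {W C} → IsComponent E W C → Nonempty C
  component-nonempty (ne , _) = ne

  component-vertices : ∀ {W C} → IsComponent E W C → vertices (restrict E C) ≡ C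
  component-vertices (_ , _ , C-vertices , _) = C-vertices

  component-connected : ∀ {W C} → IsComponent E W C → Connected (restrict E C)
  component-connected (_ , _ , _ , C-connected , _) = C-connected

  component-closed : ∀ {W C} → IsComponent E W C → ClosedIn W C
  component-closed (_ , _ , _ , _ , C-closed) = C-closed

  component⊆ : ∀ {W C} → IsComponent E W C → C ⊆ W
  component⊆ {W} (_ , C⊆ , _) = vertices-restrict⊆ W ∘ C⊆

  -- A component of 𝐇_W meeting a set S closed in some W′ ⊇ W lies inside S:
  -- otherwise its parts inside and outside S would split it.
  component⊆closed : ∀ {W W′ D S} → IsComponent E W D → W ⊆ W′ → ClosedIn W′ S →
    Nonempty (D ∩ S) → D ⊆ S
  component⊆closed {W} {W′} {D} {S} isD W⊆W′ S-closed meets {z} z∈D with z ∈? S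
  ... | yes z∈S = z∈S
  ... | no  z∉S = ⊥-elim (component-connected isD (D ∩ S) (D ─ S) cover disjoint meets
                    (z , x∈p∧x∉q⇒x∈p─q z∈D z∉S) split)
    where
    cover : (D ∩ S) ∪ (D ─ S) ≡ vertices (restrict E D)
    cover = trans (p∩q∪p─q≡p D S) (sym (component-vertices isD))
    disjoint : Disjoint (D ∩ S) (D ─ S)
    disjoint (u , u∈) = let (u∈D∩S , u∈D─S) = x∈p∩q⁻ (D ∩ S) (D ─ S) u∈ in
      x∈p─q⇒x∉q D S u∈D─S (proj₂ (x∈p∩q⁻ D S u∈D∩S))
    split : ∀ e → e ∈ₗ restrict E D → e ⊆ D ∩ S ⊎ e ⊆ D ─ S
    split e e∈ with nonempty? (e ∩ S)
    ... | yes e-meets = inj₁ λ u∈e → x∈p∩q⁺ (e⊆D u∈e , S-closed e e∈W′ e-meets u∈e)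
      where
      e⊆D = proj₂ (restrict⁻ e∈)
      e∈W′ = restrict-mono (W⊆W′ ∘ component⊆ isD) e∈
    ... | no  e-avoids = inj₂ λ {u} u∈e →
      x∈p∧x∉q⇒x∈p─q (proj₂ (restrict⁻ e∈) u∈e) (λ u∈S → e-avoids (u , x∈p∩q⁺ (u∈e , u∈S)))

  component-unique : ∀ {W D D′ u} → IsComponent E W D → IsComponent E W D′ →
    u ∈ D → u ∈ D′ → D ≡ D′
  component-unique isD isD′ u∈D u∈D′ = ⊆-antisym
    (component⊆closed isD  (λ m → m) (component-closed isD′) (_ , x∈p∩q⁺ (u∈D , u∈D′)))
    (component⊆closed isD′ (λ m → m) (component-closed isD)  (_ , x∈p∩q⁺ (u∈D′ , u∈D)))

  component-shrink : ∀ {Z W C} → Z ⊆ W → C ⊆ Z → IsComponent E W C → IsComponent E Z C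
  component-shrink Z⊆W C⊆Z (ne , _ , C-vertices , C-connected , C-closed) =
    ne , vertices-restrict-mono C⊆Z ∘ subst (_ ∈_) (sym C-vertices) , C-vertices , C-connected ,
    λ e e∈ → C-closed e (restrict-mono Z⊆W e∈)

  component-grow : ∀ {Z W C} → Z ⊆ W → IsComponent E Z C → ClosedIn W C → IsComponent E W C
  component-grow Z⊆W (ne , C⊆ , C-vertices , C-connected , _) C-closed =
    ne , vertices-restrict-mono Z⊆W ∘ C⊆ , C-vertices , C-connected , C-closed

  Components-↭ : ∀ {V X Cs Cs′} → Components E V X Cs → Cs ↭ Cs′ → Components E V X Cs′
  Components-↭ (unique , areComponents , complete) σ =
    ↭ₛ.Unique-resp-↭ (setoid _) (↭⇒↭ₛ σ) unique , All-resp-↭ σ areComponents ,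
    λ C isC → ∈-resp-↭ σ (complete C isC)

  -- The component of w in 𝐇_W, defined as the least closed set containing
  -- w: the vertices v lying in every closed set that contains w.  Closedness
  -- is decidable, so this set can be computed by enumerating all subsets.
  Reaches : Subset N → Fin N → Fin N → Set
  Reaches W w v = ∀ S → w ∈ S → ClosedIn W S → v ∈ S

  reaches? : ∀ W w v → Dec (Reaches W w v)
  reaches? W w v with anySubset? (λ S → (w ∈? S) ×-dec (ClosedIn? W S ×-dec ¬? (v ∈? S)))
  ... | yes (S , w∈S , S-closed , v∉S) = no λ reaches → v∉S (reaches S w∈S S-closed)
  ... | no  noSeparator = yes λ S w∈S S-closed →
    decidable-stable (v ∈? S) (λ v∉S → noSeparator (S , w∈S , S-closed , v∉S))

  componentOf : Subset N → Fin N → Subset N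
  componentOf W w = select (reaches? W w)

  componentOf-self : ∀ {W w} → w ∈ componentOf W w
  componentOf-self {W} {w} = ∈select⁺ (reaches? W w) (λ _ w∈S _ → w∈S)

  componentOf-least : ∀ {W w S} → w ∈ S → ClosedIn W S → componentOf W w ⊆ S
  componentOf-least {W} {w} {S} w∈S S-closed v∈ = ∈select⁻ (reaches? W w) v∈ S w∈S S-closed

  -- W itself is closed in W.
  componentOf⊆ : ∀ {W w} → w ∈ W → componentOf W w ⊆ W
  componentOf⊆ w∈W = componentOf-least w∈W (λ e e∈ _ → proj₂ (restrict⁻ e∈))

  -- The component is closed: an edge meeting it meets every closed S ∋ w.
  componentOf-closed : ∀ {W w} → ClosedIn W (componentOf W w)
  componentOf-closed {W} {w} e e∈ (z , z∈) v∈e = ∈select⁺ (reaches? W w) λ S w∈S S-closed →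
    let (z∈e , z∈K) = x∈p∩q⁻ e _ z∈ in
    S-closed e e∈ (z , x∈p∩q⁺ (z∈e , componentOf-least w∈S S-closed z∈K)) v∈e

  componentOf-unsplittable : ∀ {W w P Q} → P ⊆ componentOf W w → Q ⊆ componentOf W w →
    Disjoint P Q → (∀ e → e ∈ₗ restrict E (componentOf W w) → e ⊆ P ⊎ e ⊆ Q) →
    w ∈ P → Nonempty Q → ⊥
  componentOf-unsplittable {W} {w} {P} {Q} P⊆K Q⊆K disjoint split w∈P (q , q∈Q) =
    disjoint (q , x∈p∩q⁺ (componentOf-least w∈P P-closed (Q⊆K q∈Q) , q∈Q))
    where
    P-closed : ClosedIn W P
    P-closed e e∈ (z , z∈) with x∈p∩q⁻ e P z∈
    ... | z∈e , z∈P with split e (restrict-move e∈ (componentOf-closed e e∈ (z , x∈p∩q⁺ (z∈e , P⊆K z∈P))))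
    ... | inj₁ e⊆P = e⊆P
    ... | inj₂ e⊆Q = ⊥-elim (disjoint (z , x∈p∩q⁺ (z∈P , e⊆Q z∈e)))

  Lowerable : Subset N → Tree → Set
  Lowerable V t = ∃ λ s → IsConstruct E V s × IsConstruction s × s ≤[ E , V ] t

  AllLowerable : Subset N → Set
  AllLowerable V = ∀ {t} → IsConstruct E V t → Lowerable V t

  RootedLowering : Subset N → Fin N → Tree → Set
  RootedLowering V x t = ∃ λ ss →
    IsConstruct E V (node ⁅ x ⁆ ss) × IsConstruction (node ⁅ x ⁆ ss) × node ⁅ x ⁆ ss ≤[ E , V ] t

  RootedLowerable : Subset N → Set
  RootedLowerable V = ∀ {X ts} → IsConstruct E V (node X ts) → ∀ {x} → x ∈ X →
    RootedLowering V x (node X ts)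

  -- Every construct has a non-empty root label, so the theorem for 𝐇_V
  -- makes every construct of 𝐇_V lowerable.
  lowerable : ∀ {V} → RootedLowerable V → AllLowerable V
  lowerable rooted c@(mk _ (x , x∈X) _ _ _) =
    let (ss , cₛ , sConstruction , s≤t) = rooted c x∈X in node ⁅ x ⁆ ss , cₛ , sConstruction , s≤t

  construct-↭ : ∀ {V Y ts ts′} → IsConstruct E V (node Y ts) → ts ↭ ts′ → IsConstruct E V (node Y ts′)
  construct-↭ (mk Cs ne Y⊆V comps cs) σ =
    let (Cs′ , τ , cs′) = Pointwise-↭ʳ cs σ in mk Cs′ ne Y⊆V (Components-↭ comps τ) cs′

  -- Rule (ii) at an arbitrary child position: move the child to the front,
  -- apply the rule, and move it back.
  congrAt : ∀ {V Y Cs₁ C Cs₂ ts₁ t t′ ts₂} → Nonempty Y → Y ⊆ V →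
    Components E V Y (Cs₁ ++ C ∷ Cs₂) →
    Pointwise (IsConstruct E) Cs₁ ts₁ → Pointwise (IsConstruct E) Cs₂ ts₂ →
    IsConstruct E C t → IsConstruct E C t′ → t ≤[ E , C ] t′ →
    node Y (ts₁ ++ t ∷ ts₂) ≤[ E , V ] node Y (ts₁ ++ t′ ∷ ts₂)
  congrAt {V} {Y} {Cs₁} {C} {Cs₂} {ts₁} {t} {t′} {ts₂} ne Y⊆V comps cs₁ cs₂ c c′ t≤t′ =
    trans′ (perm (mk _ ne Y⊆V comps (Pointwise.++⁺ cs₁ (c ∷ cs₂))) (shift t ts₁ ts₂))
   (trans′ (congr ne Y⊆V comps′ (Pointwise.++⁺ cs₁ cs₂) t≤t′)
           (perm (mk _ ne Y⊆V comps′ (c′ ∷ Pointwise.++⁺ cs₁ cs₂)) (↭-sym (shift t′ ts₁ ts₂))))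
    where
    comps′ : Components E V Y (C ∷ Cs₁ ++ Cs₂)
    comps′ = Components-↭ comps (shift C Cs₁ Cs₂)

  -- Lowering the children Cs one by one (the children us of Ds being already
  -- done): if every component in Cs is lowerable, the tree lies above one
  -- whose children below Cs are constructions.
  lowerChildren : ∀ {V Y} → Nonempty Y → Y ⊆ V → ∀ Ds Cs {us ts} →
    Components E V Y (Ds ++ Cs) → Pointwise (IsConstruct E) Ds us →
    Pointwise (IsConstruct E) Cs ts → All AllLowerable Cs →
    ∃ λ ss → Pointwise (IsConstruct E) Cs ss × All IsConstruction ss ×
             node Y (us ++ ss) ≤[ E , V ] node Y (us ++ ts)
  lowerChildren ne Y⊆V Ds [] comps csᵤ [] [] =
    [] , [] , [] , refl′ (mk (Ds ++ []) ne Y⊆V comps (Pointwise.++⁺ csᵤ []))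
  lowerChildren {V} {Y} ne Y⊆V Ds (C ∷ Cs) {us} {t ∷ ts} comps csᵤ (c ∷ cs) (lowerC ∷ lowerCs) =
    let (s , cₛ , sConstruction , s≤t) = lowerC c
        (ss , cₛₛ , ssConstruction , done≤) =
          lowerChildren ne Y⊆V (Ds ++ [ C ]) Cs (subst (Components E V Y) (sym (++-assoc Ds [ C ] Cs)) comps)
            (Pointwise.++⁺ csᵤ (cₛ ∷ [])) cs lowerCs
    in s ∷ ss , cₛ ∷ cₛₛ , sConstruction ∷ ssConstruction ,
       trans′ (subst₂ (λ l r → node Y l ≤[ E , V ] node Y r) (++-assoc us [ s ] ss) (++-assoc us [ s ] ts) done≤)
              (congrAt ne Y⊆V comps csᵤ cs cₛ c s≤t)

  singletonRoot : ∀ {V x ts} → (∀ {C} → IsComponent E (V ─ ⁅ x ⁆) C → AllLowerable C) →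
    IsConstruct E V (node ⁅ x ⁆ ts) → RootedLowering V x (node ⁅ x ⁆ ts)
  singletonRoot lowerComponent (mk Cs ne x⊆V comps cs) =
    let (ss , cₛₛ , ssConstruction , ss≤ts) =
          lowerChildren ne x⊆V [] Cs comps [] cs (All.map lowerComponent (proj₁ (proj₂ comps)))
    in ss , mk Cs ne x⊆V comps cₛₛ , mk ssConstruction , ss≤ts

  module _ (atomic : Atomic E) where

    atomic-vertex : ∀ {A v} → v ∈ A → v ∈ vertices E → v ∈ vertices (restrict E A)
    atomic-vertex {A} {v} v∈A v∈E =
      ∈⋃⁺ (restrict E A) (restrict⁺ (atomic v v∈E) (λ u∈v → subst (_∈ A) (sym (x∈⁅y⁆⇒x≡y v u∈v)) v∈A))
        (x∈⁅x⁆ v)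

    componentOf-vertices : ∀ {W w} → W ⊆ vertices E → w ∈ W →
      vertices (restrict E (componentOf W w)) ≡ componentOf W w
    componentOf-vertices W⊆E w∈W = ⊆-antisym (vertices-restrict⊆ _)
      (λ v∈K → atomic-vertex v∈K (W⊆E (componentOf⊆ w∈W v∈K)))

    componentOf-connected : ∀ {W w} → W ⊆ vertices E → w ∈ W → Connected (restrict E (componentOf W w))
    componentOf-connected {W} {w} W⊆E w∈W X₁ X₂ cover disjoint ne₁ ne₂ split =
      [ (λ w∈X₁ → componentOf-unsplittable X₁⊆K X₂⊆K disjoint split w∈X₁ ne₂)
      , (λ w∈X₂ → componentOf-unsplittable X₂⊆K X₁⊆K (subst Empty (∩-comm X₁ X₂) disjoint)
                    (λ e e∈ → Sum.swap (split e e∈)) w∈X₂ ne₁)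
      ]′ (x∈p∪q⁻ X₁ X₂ (subst (w ∈_) (sym (trans cover (componentOf-vertices W⊆E w∈W))) componentOf-self))
      where
      X₁⊆K : X₁ ⊆ componentOf W w
      X₁⊆K x∈ = vertices-restrict⊆ _ (subst (_ ∈_) cover (x∈p∪q⁺ (inj₁ x∈)))
      X₂⊆K : X₂ ⊆ componentOf W w
      X₂⊆K x∈ = vertices-restrict⊆ _ (subst (_ ∈_) cover (x∈p∪q⁺ (inj₂ x∈)))

    componentOf-isComponent : ∀ {W w} → W ⊆ vertices E → w ∈ W → IsComponent E W (componentOf W w)
    componentOf-isComponent W⊆E w∈W =
      (_ , componentOf-self) ,
      (λ v∈K → atomic-vertex (componentOf⊆ w∈W v∈K) (W⊆E (componentOf⊆ w∈W v∈K))) ,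
      componentOf-vertices W⊆E w∈W , componentOf-connected W⊆E w∈W , componentOf-closed

    module Unmerge {V X : Subset N} {Cs : List (Subset N)} {y : Fin N}
                   (V⊆E : V ⊆ vertices E) (X⊆V : X ⊆ V)
                   (comps : Components E V X Cs) (y∈X : y ∈ X) where

      Y : Subset N
      Y = X - y

      W W′ : Subset N
      W = V ─ X
      W′ = V ─ Y

      K : Subset N
      K = componentOf W′ y

      -- the old components inside K, which end up below {y}, and the others
      A B : List (Subset N)
      A = filter (_⊆? K) Cs
      B = filter (¬? ∘ (_⊆? K)) Cs

      W⊆W′ : W ⊆ W′
      W⊆W′ = ─-antitoneʳ V (p─q⊆p X ⁅ y ⁆)

      y∉W : y ∉ W
      y∉W y∈W = x∈p─q⇒x∉q V X y∈W y∈X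

      W′⊆W∪y : ∀ {u} → u ∈ W′ → u ≢ y → u ∈ W
      W′⊆W∪y = x∈p─[q-y]⇒x∈p─q V X

      W∌y : ∀ {u} → u ∈ W → u ∉ ⁅ y ⁆
      W∌y u∈W u∈y = y∉W (subst (_∈ W) (x∈⁅y⁆⇒x≡y y u∈y) u∈W)

      isK : IsComponent E W′ K
      isK = componentOf-isComponent (V⊆E ∘ p─q⊆p V Y)
              (x∈p∧x∉q⇒x∈p─q (X⊆V y∈X) (λ y∈Y → x∈p─q⇒x∉q X ⁅ y ⁆ y∈Y (x∈⁅x⁆ y)))

      y∈K : y ∈ K
      y∈K = componentOf-self

      isOld : ∀ {C} → C ∈ₗ Cs → IsComponent E W C
      isOld = All.lookup (proj₁ (proj₂ comps))

      componentsAbove : Components E V Y (K ∷ B)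
      componentsAbove =
        (All.tabulate K≢B AllPairs.∷ Unique.filter⁺ _ (proj₁ comps)) , isK ∷ All.tabulate isB , complete
        where
        K≢B : ∀ {C} → C ∈ₗ B → K ≢ C
        K≢B C∈B refl = y∉W (component⊆ (isOld (proj₁ (∈-filter⁻ _ C∈B))) y∈K)
        -- An edge of 𝐇_{W′} meeting an old component C ⊈ K avoids y (it
        -- would otherwise join C to K), so it is an edge of 𝐇_W.
        closedAbove : ∀ {C} → C ∈ₗ Cs → ¬ C ⊆ K → ClosedIn W′ C
        closedAbove {C} C∈Cs C⊈K e e∈ (c , c∈) with x∈p∩q⁻ e C c∈ | y ∈? e
        ... | c∈e , c∈C | yes y∈e = ⊥-elim (C⊈K (component⊆closed (isOld C∈Cs) W⊆W′ (component-closed isK)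
                (c , x∈p∩q⁺ (c∈C , component-closed isK e e∈ (y , x∈p∩q⁺ (y∈e , y∈K)) c∈e))))
        ... | _ | no y∉e = component-closed (isOld C∈Cs) e
                (restrict-move e∈ (λ u∈e → W′⊆W∪y (proj₂ (restrict⁻ e∈) u∈e)
                                     (λ u≡y → y∉e (subst (_∈ e) u≡y u∈e))))
                (c , c∈)
        isB : ∀ {C} → C ∈ₗ B → IsComponent E W′ C
        isB C∈B = let (C∈Cs , C⊈K) = ∈-filter⁻ _ C∈B in
          component-grow W⊆W′ (isOld C∈Cs) (closedAbove C∈Cs C⊈K)
        -- A component of 𝐇_{W′} is K if it contains y, and else an old one.
        complete : ∀ D → IsComponent E W′ D → D ∈ₗ K ∷ B
        complete D isD with y ∈? D
        ... | yes y∈D = here (component-unique isD isK y∈D y∈K)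
        ... | no  y∉D = there (∈-filter⁺ _ (proj₂ (proj₂ comps) D isD-old) D⊈K)
          where
          isD-old : IsComponent E W D
          isD-old = component-shrink W⊆W′
            (λ u∈D → W′⊆W∪y (component⊆ isD u∈D) (λ u≡y → y∉D (subst (_∈ D) u≡y u∈D))) isD
          D⊈K : ¬ D ⊆ K
          D⊈K D⊆K = let (d , d∈D) = component-nonempty isD in
            y∉D (subst (y ∈_) (component-unique isK isD (D⊆K d∈D) d∈D) y∈K)

      componentsBelow : Components E K ⁅ y ⁆ A
      componentsBelow = Unique.filter⁺ _ (proj₁ comps) , All.tabulate isA , complete
        where
        Z⊆W : K ─ ⁅ y ⁆ ⊆ W
        Z⊆W u∈ = W′⊆W∪y (component⊆ isK (p─q⊆p K ⁅ y ⁆ u∈)) (x∉⁅y⁆⇒x≢y (x∈p─q⇒x∉q K ⁅ y ⁆ u∈))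
        isA : ∀ {C} → C ∈ₗ A → IsComponent E (K ─ ⁅ y ⁆) C
        isA C∈A = let (C∈Cs , C⊆K) = ∈-filter⁻ _ C∈A in
          component-shrink Z⊆W (λ u∈C → x∈p∧x∉q⇒x∈p─q (C⊆K u∈C) (W∌y (component⊆ (isOld C∈Cs) u∈C)))
            (isOld C∈Cs)
        -- An edge of 𝐇_W meeting D ⊆ K lies in K (K is closed) and avoids y.
        closedBelow : ∀ {D} → IsComponent E (K ─ ⁅ y ⁆) D → ClosedIn W D
        closedBelow {D} isD e e∈ (d , d∈) =
          component-closed isD e (restrict-move e∈ e⊆K─y) (d , d∈)
          where
          e⊆K : e ⊆ K
          e⊆K = component-closed isK e (restrict-mono W⊆W′ e∈)
            (d , x∈p∩q⁺ (proj₁ (x∈p∩q⁻ e D d∈) , p─q⊆p K ⁅ y ⁆ (component⊆ isD (proj₂ (x∈p∩q⁻ e D d∈)))))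
          e⊆K─y : e ⊆ K ─ ⁅ y ⁆
          e⊆K─y u∈e = x∈p∧x∉q⇒x∈p─q (e⊆K u∈e) (W∌y (proj₂ (restrict⁻ e∈) u∈e))
        complete : ∀ D → IsComponent E (K ─ ⁅ y ⁆) D → D ∈ₗ A
        complete D isD = ∈-filter⁺ _ (proj₂ (proj₂ comps) D (component-grow Z⊆W isD (closedBelow isD)))
          (λ {u} u∈D → p─q⊆p K ⁅ y ⁆ (component⊆ isD u∈D))

      Y∪⁅y⁆≡X : Y ∪ ⁅ y ⁆ ≡ X
      Y∪⁅y⁆≡X = p-x∪⁅x⁆≡p y∈X

      Y≢V : ¬ Y ≡ V
      Y≢V Y≡V = x∈p─q⇒x∉q X ⁅ y ⁆ (subst (y ∈_) (sym Y≡V) (X⊆V y∈X)) (x∈⁅x⁆ y)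

    unmerge : ∀ {V X ts y} → V ⊆ vertices E → IsConstruct E V (node X ts) → y ∈ X → Nonempty (X - y) →
      ∃₂ λ tsᴬ tsᴮ → IsConstruct E V (node (X - y) (node ⁅ y ⁆ tsᴬ ∷ tsᴮ)) ×
                     node (X - y) (node ⁅ y ⁆ tsᴬ ∷ tsᴮ) ≤[ E , V ] node X ts
    unmerge {V} {X} {ts} {y} V⊆E c@(mk Cs _ X⊆V comps cs) y∈X Y≠∅ =
      let open Unmerge V⊆E X⊆V comps y∈X
          (tsᴬ , tsᴮ , csᴬ , csᴮ , σ) = Pointwise-partition (_⊆? K) cs
          below : IsConstruct E K (node ⁅ y ⁆ tsᴬ)
          below = mk A (y , x∈⁅x⁆ y) (λ u∈y → subst (_∈ K) (sym (x∈⁅y⁆⇒x≡y y u∈y)) y∈K) componentsBelow csᴬ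
          unmerged : IsConstruct E V (node Y (node ⁅ y ⁆ tsᴬ ∷ tsᴮ))
          unmerged = mk (K ∷ B) Y≠∅ (X⊆V ∘ p─q⊆p X ⁅ y ⁆) componentsAbove (below ∷ csᴮ)
      in tsᴬ , tsᴮ , unmerged ,
         trans′ (subst (λ Z → node Y (node ⁅ y ⁆ tsᴬ ∷ tsᴮ) ≤[ E , V ] node Z (tsᴬ ++ tsᴮ))
                       Y∪⁅y⁆≡X (merge Y≢V unmerged))
                (perm (construct-↭ c σ) (↭-sym σ))

    shrinkRoot : ∀ {V x} → V ⊆ vertices E →
      (∀ {ts} → IsConstruct E V (node ⁅ x ⁆ ts) → RootedLowering V x (node ⁅ x ⁆ ts)) →
      ∀ k {X ts} → ∣ X ∣ < k → IsConstruct E V (node X ts) → x ∈ X → RootedLowering V x (node X ts)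
    shrinkRoot V⊆E singleton zero |X|<0 = ⊥-elim (ℕ.n≮0 |X|<0)
    shrinkRoot V⊆E singleton (suc k) |X|≤k c x∈X with ⁅x⁆-or-other x∈X
    ... | inj₁ refl = singleton c
    ... | inj₂ (y , y∈X , y≢x) =
      let x∈X-y = x∈p∧x≢y⇒x∈p-y x∈X (y≢x ∘ sym)
          (tsᴬ , tsᴮ , unmerged , unmerged≤t) = unmerge V⊆E c y∈X (_ , x∈X-y)
          (ss , cₛ , sConstruction , s≤unmerged) = shrinkRoot V⊆E singleton k
            (ℕ.<-≤-trans (x∈p⇒∣p-x∣<∣p∣ y∈X) (ℕ.≤-pred |X|≤k)) unmerged x∈X-y
      in ss , cₛ , sConstruction , trans′ s≤unmerged unmerged≤t

    -- The theorem for 𝐇_V, by induction on a bound n for |V|: the components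
    -- below a singleton root are strictly smaller than V.
    rootedLowering : ∀ n {V} → ∣ V ∣ < n → V ⊆ vertices E → RootedLowerable V
    rootedLowering zero |V|<0 = ⊥-elim (ℕ.n≮0 |V|<0)
    rootedLowering (suc n) {V} |V|≤n V⊆E c@(mk _ _ X⊆V _ _) {x} x∈X =
      shrinkRoot V⊆E (singletonRoot lowerComponent) _ (ℕ.n<1+n _) c x∈X
      where
      lowerComponent : ∀ {C} → IsComponent E (V ─ ⁅ x ⁆) C → AllLowerable C
      lowerComponent isC = lowerable (rootedLowering n
        (ℕ.<-≤-trans (ℕ.≤-<-trans (p⊆q⇒∣p∣≤∣q∣ (component⊆ isC)) (x∈p⇒∣p-x∣<∣p∣ (X⊆V x∈X))) (ℕ.≤-pred |V|≤n))
        (V⊆E ∘ p─q⊆p V ⁅ x ⁆ ∘ component⊆ isC))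

corollary1 : (N : ℕ) (E : Hypergraph {N}) →
    NoEmptyEdge E → Atomic E → Connected E →
    (X : Subset N) (ts : List Tree) →
    IsConstruct E (vertices E) (node X ts) →
    (x : Fin N) → x ∈ X →
    ∃ λ (ss : List Tree) →
    IsConstruct E (vertices E) (node ⁅ x ⁆ ss) ×
    IsConstruction (node ⁅ x ⁆ ss) ×
    node ⁅ x ⁆ ss ≤[ E , vertices E ] node X ts
corollary1 N E _ atomic _ X ts c x x∈X =
  rootedLowering E atomic (suc ∣ vertices E ∣) (ℕ.n<1+n _) (λ v∈ → v∈) c x∈X
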